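{- For any integers $2<k<n$, the lattice of flats of the uniform matroid $U(k,n)$ is not isomorphic to the core of any upho lattice.
   Context: For $2\le k\le n$, the lattice of flats of the uniform matroid $U(k,n)$ is the poset obtained from the Boolean lattice $B_n$ (subsets of $\{1,\ldots,n\}$ ordered by inclusion) by removing all subsets of size $\ge k$ and then adjoining a new maximum element $\hat1$. A poset $\mathcal{P}$ is finite type $\mathbb{N}$-graded if it has a minimum $\hat0$, a rank function $\rho$ with $\rho(\hat0)=0$ such that every maximal chain has the form $\hat0=x_0\lessdot x_1\lessdot\cdots$ with $\rho(x_i)=i$, and finitely many elements of each rank. An upho lattice is a finite type $\mathbb{N}$-graded lattice $\mathcal{L}$ with at least two elements such that for every $p\in\mathcal{L}$ the principal filter $\{q\ge p\}$ is isomorphic to $\mathcal{L}$. Its core is the interval $[\hat0,s_1\vee\cdots\vee s_r]$ with $s_1,\ldots,s_r$ the atoms of $\mathcal{L}$. -}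

module Defs where

open import Level using (0ℓ)
open import Data.Nat as ℕ using (ℕ; zero; suc)
open import Data.Fin.Subset using (Subset; _⊆_; ∣_∣)
open import Data.Product using (Σ; Σ-syntax; ∃; _×_; _,_)
open import Data.Sum using (_⊎_)
open import Data.List using (List)
open import Data.List.Membership.Propositional using (_∈_)
open import Data.Empty using (⊥)
open import Relation.Nullary using (¬_)
open import Relation.Binary.PropositionalEquality using (_≡_)
open import Function.Bundles using (_⇔_)

record Poset : Set₁ where
  infix 4 _≤_
  field
    Carrier : Set
    _≤_     : Carrier → Carrier → Set
    refl    : ∀ {x} → x ≤ x
    trans   : ∀ {x y z} → x ≤ y → y ≤ z → x ≤ z
    antisym : ∀ {x y} → x ≤ y → y ≤ x → x ≡ y

module PosetNotions (P : Poset) where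
  open Poset P

  _<ₚ_ : Carrier → Carrier → Set
  x <ₚ y = x ≤ y × ¬ (x ≡ y)

  _⋖_ : Carrier → Carrier → Set
  x ⋖ y = x <ₚ y × (∀ z → x ≤ z → z ≤ y → (z ≡ x) ⊎ (z ≡ y))

  IsJoin : Carrier → Carrier → Carrier → Set
  IsJoin x y j = (x ≤ j × y ≤ j) × (∀ u → x ≤ u → y ≤ u → j ≤ u)

  IsMeet : Carrier → Carrier → Carrier → Set
  IsMeet x y m = (m ≤ x × m ≤ y) × (∀ l → l ≤ x → l ≤ y → l ≤ m)

  IsLattice : Set
  IsLattice = (∀ x y → Σ[ j ∈ Carrier ] IsJoin x y j)
            × (∀ x y → Σ[ m ∈ Carrier ] IsMeet x y m)

  IsChain : (Carrier → Set) → Set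
  IsChain C = ∀ x y → C x → C y → (x ≤ y) ⊎ (y ≤ x)

  IsMaximalChain : (Carrier → Set) → Set
  IsMaximalChain C = IsChain C × (∀ z → (∀ x → C x → (z ≤ x) ⊎ (x ≤ z)) → C z)

  data ChainForm (b : Carrier) (ρ : Carrier → ℕ) (C : Carrier → Set) : Set where
    infinite : (x : ℕ → Carrier) → x 0 ≡ b
             → (∀ i → x i ⋖ x (suc i))
             → (∀ i → ρ (x i) ≡ i)
             → (∀ c → C c ⇔ (Σ[ i ∈ ℕ ] x i ≡ c))
             → ChainForm b ρ C
    finite   : (m : ℕ) (x : ℕ → Carrier) → x 0 ≡ b
             → (∀ i → i ℕ.< m → x i ⋖ x (suc i))
             → (∀ i → i ℕ.≤ m → ρ (x i) ≡ i)
             → (∀ c → C c ⇔ (Σ[ i ∈ ℕ ] (i ℕ.≤ m × x i ≡ c)))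
             → ChainForm b ρ C

  record FiniteTypeNGraded : Set₁ where
    field
      𝟘        : Carrier
      𝟘-min    : ∀ x → 𝟘 ≤ x
      ρ        : Carrier → ℕ
      ρ𝟘       : ρ 𝟘 ≡ 0
      maxChain : ∀ (C : Carrier → Set) → IsMaximalChain C → ChainForm 𝟘 ρ C
      finRank  : ∀ r → Σ[ xs ∈ List Carrier ] (∀ x → ρ x ≡ r → x ∈ xs)

  FilterIso : Carrier → Set
  FilterIso p = Σ[ f ∈ (Carrier → Carrier) ]
      (∀ x → p ≤ f x)
    × (∀ y → p ≤ y → Σ[ x ∈ Carrier ] f x ≡ y)
    × (∀ x x' → (x ≤ x') ⇔ (f x ≤ f x'))

  IntervalIso : (A : Set) → (A → A → Set) → Carrier → Carrier → Set
  IntervalIso A _⊑_ a b = Σ[ f ∈ (A → Carrier) ]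
      (∀ x → a ≤ f x × f x ≤ b)
    × (∀ y → a ≤ y → y ≤ b → Σ[ x ∈ A ] f x ≡ y)
    × (∀ x x' → (x ⊑ x') ⇔ (f x ≤ f x'))

record UphoLattice : Set₂ where
  field
    poset     : Poset
  open Poset poset public
  open PosetNotions poset public
  field
    lattice   : IsLattice
    graded    : FiniteTypeNGraded
    twoElems  : Σ[ x ∈ Carrier ] Σ[ y ∈ Carrier ] ¬ (x ≡ y)
    upho      : ∀ p → FilterIso p
  open FiniteTypeNGraded graded public

  IsAtom : Carrier → Set
  IsAtom s = 𝟘 ⋖ s

  IsJoinOfAtoms : Carrier → Set
  IsJoinOfAtoms t = (∀ s → IsAtom s → s ≤ t)
                  × (∀ u → (∀ s → IsAtom s → s ≤ u) → t ≤ u)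

  CoreIso : (A : Set) → (A → A → Set) → Set
  CoreIso A _⊑_ = Σ[ t ∈ Carrier ] (IsJoinOfAtoms t × IntervalIso A _⊑_ 𝟘 t)

-- Lattice of flats of the uniform matroid U(k,n):
-- subsets of {1..n} of size < k, plus a new maximum.

data Flat (k n : ℕ) : Set where
  sub : (S : Subset n) → ∣ S ∣ ℕ.< k → Flat k n
  top : Flat k n

data _≤F_ {k n : ℕ} : Flat k n → Flat k n → Set where
  sub≤sub : ∀ {S T p q} → S ⊆ T → sub S p ≤F sub T q
  _≤top   : ∀ x → x ≤F top

{-# OPTIONS --safe #-}
module Submission where

open import Defs
open import Data.Nat using (ℕ; _<_)
open import Relation.Nullary using (¬_)

open import Data.Nat as ℕ using (suc; z≤n; s≤s)
open import Data.Nat.Properties using (≤-<-trans; <-≤-trans; <-trans; n<1+n; n≮n)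
open import Data.Fin using (Fin; zero; suc; fromℕ<)
open import Data.Fin.Properties using (suc-injective; 0≢1+n; injective⇒≤)
open import Data.Fin.Subset using (Subset; _⊆_; ∣_∣; ⁅_⁆; _∈_; _-_; inside)
  renaming (⊥ to ∅)
open import Data.Fin.Subset.Properties
  using (x∈⁅y⁆⇒x≡y; x∈⁅x⁆; drop-there; ∉⊥; ⊥⊆; ∣⁅x⁆∣≡1; ∣⊥∣≡0; x∈p∧x≢y⇒x∈p-y; x∈p⇒∣p-x∣<∣p∣; _∈?_; nonempty?)
open import Data.Vec using (_∷_; here; there)
open import Data.Product using (Σ-syntax; _×_; _,_; proj₁; proj₂)
open import Data.Sum using (_⊎_; inj₁; inj₂)
open import Data.Empty using (⊥-elim)
open import Relation.Nullary using (yes; no)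
open import Relation.Binary.PropositionalEquality using (_≡_; refl; sym; trans; cong; subst; subst₂)
open import Function.Base using (_∘_)
open import Function.Bundles using (module Equivalence)
open import Function.Definitions using (Injective)

-- Let s = {1} ∈ core ≅ Flat k n and let f be the isomorphism of L onto the filter
-- above s; f maps atoms of L onto the elements covering s.  The n − 1 covers {1, j}
-- of s in the core (these are flats because k > 2) pull back to n − 1 ≥ k distinct
-- atoms, lying below t = ⋁ atoms and below w = f⁻¹(t).  So w ∧ t is a flat containing
-- at least k points, i.e. it is t itself, and t ≤ w.  Hence f maps the core into
-- itself, and sends the n atoms {q} of the core injectively to covers of s inside
-- the core.  These are only the n − 1 pairs {1, j}: a contradiction by pigeonhole.

Covers : {A : Set} → (A → A → Set) → A → A → Set
Covers _⊑_ x y = x ⊑ y × ¬ (y ⊑ x) × (∀ z → x ⊑ z → z ⊑ y → (z ⊑ x) ⊎ (y ⊑ z))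

∈-injection⇒≤∣p∣ : ∀ {r n} (x : Fin r → Fin n) → Injective _≡_ _≡_ x
                 → (p : Subset n) → (∀ i → x i ∈ p) → r ℕ.≤ ∣ p ∣
∈-injection⇒≤∣p∣ {0}     x x-inj p x∈p = z≤n
∈-injection⇒≤∣p∣ {suc r} x x-inj p x∈p =
  ≤-<-trans (∈-injection⇒≤∣p∣ (x ∘ suc) (suc-injective ∘ x-inj) (p - x zero) x∈p-x₀)
            (x∈p⇒∣p-x∣<∣p∣ (x∈p zero))
  where
  x∈p-x₀ : ∀ i → x (suc i) ∈ p - x zero
  x∈p-x₀ i = x∈p∧x≢y⇒x∈p-y (x∈p (suc i)) (0≢1+n ∘ sym ∘ x-inj)

x∈p⇒⁅x⁆⊆p : ∀ {n} {x : Fin n} {p : Subset n} → x ∈ p → ⁅ x ⁆ ⊆ p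
x∈p⇒⁅x⁆⊆p {x = x} {p} x∈p y∈⁅x⁆ = subst (_∈ p) (sym (x∈⁅y⁆⇒x≡y x y∈⁅x⁆)) x∈p

module PosetProperties (P : Poset) where
  open Poset P renaming (refl to ≤-refl; trans to ≤-trans)
  open PosetNotions P
  open Equivalence

  ≡⇒≤ : ∀ {x y} → x ≡ y → x ≤ y
  ≡⇒≤ refl = ≤-refl

  ⋖-<ₚ-≤⇒≡ : ∀ {a b c} → a ⋖ b → a <ₚ c → c ≤ b → c ≡ b
  ⋖-<ₚ-≤⇒≡ (_ , squeeze) (a≤c , a≢c) c≤b with squeeze _ a≤c c≤b
  ... | inj₁ c≡a = ⊥-elim (a≢c (sym c≡a))
  ... | inj₂ c≡b = c≡b

  module FilterIsoProperties {𝟘 : Carrier} (𝟘-min : ∀ x → 𝟘 ≤ x) {p : Carrier} (iso : FilterIso p) where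
    f : Carrier → Carrier
    f = proj₁ iso

    p≤f : ∀ x → p ≤ f x
    p≤f = proj₁ (proj₂ iso)

    f-onto : ∀ y → p ≤ y → Σ[ x ∈ Carrier ] f x ≡ y
    f-onto = proj₁ (proj₂ (proj₂ iso))

    f-mono : ∀ {x y} → x ≤ y → f x ≤ f y
    f-mono {x} {y} = to (proj₂ (proj₂ (proj₂ iso)) x y)

    f-reflects : ∀ {x y} → f x ≤ f y → x ≤ y
    f-reflects {x} {y} = from (proj₂ (proj₂ (proj₂ iso)) x y)

    f-injective : ∀ {x y} → f x ≡ f y → x ≡ y
    f-injective e = antisym (f-reflects (≡⇒≤ e)) (f-reflects (≡⇒≤ (sym e)))

    f𝟘≡p : f 𝟘 ≡ p
    f𝟘≡p with f-onto p ≤-refl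
    ... | x , fx≡p = antisym (subst (f 𝟘 ≤_) fx≡p (f-mono (𝟘-min x))) (p≤f 𝟘)

    atom⇒p⋖f : ∀ {a} → 𝟘 ⋖ a → p ⋖ f a
    atom⇒p⋖f {a} ((_ , 𝟘≢a) , squeeze) = (p≤f a , p≢fa) , squeezeₚ
      where
      p≢fa : ¬ (p ≡ f a)
      p≢fa e = 𝟘≢a (f-injective (trans f𝟘≡p e))

      squeezeₚ : ∀ z → p ≤ z → z ≤ f a → (z ≡ p) ⊎ (z ≡ f a)
      squeezeₚ z p≤z z≤fa with f-onto z p≤z
      ... | x , refl with squeeze x (𝟘-min x) (f-reflects z≤fa)
      ... | inj₁ x≡𝟘 = inj₁ (trans (cong f x≡𝟘) f𝟘≡p)
      ... | inj₂ x≡a = inj₂ (cong f x≡a)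

    p⋖f⇒atom : ∀ {a} → p ⋖ f a → 𝟘 ⋖ a
    p⋖f⇒atom {a} ((_ , p≢fa) , squeeze) = (𝟘-min a , 𝟘≢a) , squeeze𝟘
      where
      𝟘≢a : ¬ (𝟘 ≡ a)
      𝟘≢a e = p≢fa (trans (sym f𝟘≡p) (cong f e))

      squeeze𝟘 : ∀ z → 𝟘 ≤ z → z ≤ a → (z ≡ 𝟘) ⊎ (z ≡ a)
      squeeze𝟘 z _ z≤a with squeeze (f z) (p≤f z) (f-mono z≤a)
      ... | inj₁ fz≡p  = inj₁ (f-injective (trans fz≡p (sym f𝟘≡p)))
      ... | inj₂ fz≡fa = inj₂ (f-injective fz≡fa)

  module IntervalIsoProperties {A : Set} {_⊑_ : A → A → Set} {a b : Carrier}
                               (iso : IntervalIso A _⊑_ a b) where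
    φ : A → Carrier
    φ = proj₁ iso

    a≤φ : ∀ x → a ≤ φ x
    a≤φ x = proj₁ (proj₁ (proj₂ iso) x)

    φ≤b : ∀ x → φ x ≤ b
    φ≤b x = proj₂ (proj₁ (proj₂ iso) x)

    φ-onto : ∀ y → a ≤ y → y ≤ b → Σ[ x ∈ A ] φ x ≡ y
    φ-onto = proj₁ (proj₂ (proj₂ iso))

    φ-mono : ∀ {x y} → x ⊑ y → φ x ≤ φ y
    φ-mono {x} {y} = to (proj₂ (proj₂ (proj₂ iso)) x y)

    φ-reflects : ∀ {x y} → φ x ≤ φ y → x ⊑ y
    φ-reflects {x} {y} = from (proj₂ (proj₂ (proj₂ iso)) x y)

    φ-least : ∀ {⊥A} → (∀ x → ⊥A ⊑ x) → φ ⊥A ≡ a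
    φ-least {⊥A} least with φ-onto a ≤-refl (≤-trans (a≤φ ⊥A) (φ≤b ⊥A))
    ... | x , φx≡a = antisym (subst (φ ⊥A ≤_) φx≡a (φ-mono (least x))) (a≤φ ⊥A)

    φ-greatest : ∀ {⊤A} → (∀ x → x ⊑ ⊤A) → φ ⊤A ≡ b
    φ-greatest {⊤A} greatest with φ-onto b (≤-trans (a≤φ ⊤A) (φ≤b ⊤A)) ≤-refl
    ... | x , φx≡b = antisym (φ≤b ⊤A) (subst (_≤ φ ⊤A) φx≡b (φ-mono (greatest x)))

    φ-covers : ∀ {x y} → Covers _⊑_ x y → φ x ⋖ φ y
    φ-covers {x} {y} (x⊑y , y⋢x , squeeze) = (φ-mono x⊑y , φx≢φy) , squeezeφ
      where
      φx≢φy : ¬ (φ x ≡ φ y)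
      φx≢φy e = y⋢x (φ-reflects (≡⇒≤ (sym e)))

      squeezeφ : ∀ z → φ x ≤ z → z ≤ φ y → (z ≡ φ x) ⊎ (z ≡ φ y)
      squeezeφ z φx≤z z≤φy with φ-onto z (≤-trans (a≤φ x) φx≤z) (≤-trans z≤φy (φ≤b y))
      ... | z′ , refl with squeeze z′ (φ-reflects φx≤z) (φ-reflects z≤φy)
      ... | inj₁ z′⊑x = inj₁ (antisym (φ-mono z′⊑x) φx≤z)
      ... | inj₂ y⊑z′ = inj₂ (antisym z≤φy (φ-mono y⊑z′))

-- The paper's point 1 is zero : Fin (suc m), so pair j is {1, j + 2}.
module UniformFlats {k m : ℕ} (2<k : 2 < k) where
  1<k : 1 < k
  1<k = <-trans (n<1+n 1) 2<k

  0<k : 0 < k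
  0<k = <-trans (n<1+n 0) 1<k

  ∅F : Flat k (suc m)
  ∅F = sub ∅ (subst (_< k) (sym (∣⊥∣≡0 (suc m))) 0<k)

  sing : Fin (suc m) → Flat k (suc m)
  sing q = sub ⁅ q ⁆ (subst (_< k) (sym (∣⁅x⁆∣≡1 q)) 1<k)

  pair : Fin m → Flat k (suc m)
  pair j = sub (inside ∷ ⁅ j ⁆) (subst (λ c → suc c < k) (sym (∣⁅x⁆∣≡1 j)) 2<k)

  ∅F-least : ∀ x → ∅F ≤F x
  ∅F-least (sub S _) = sub≤sub ⊥⊆
  ∅F-least top       = ∅F ≤top

  sing≤sub⇒∈ : ∀ {q S p} → sing q ≤F sub S p → q ∈ S
  sing≤sub⇒∈ {q} (sub≤sub ⁅q⁆⊆S) = ⁅q⁆⊆S (x∈⁅x⁆ q)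

  sing-injective : ∀ {q q′} → sing q ≤F sing q′ → q ≡ q′
  sing-injective {q′ = q′} sing≤sing = x∈⁅y⁆⇒x≡y q′ (sing≤sub⇒∈ sing≤sing)

  pair-injective : ∀ {j j′} → pair j ≤F pair j′ → j ≡ j′
  pair-injective {j} {j′} (sub≤sub h) = x∈⁅y⁆⇒x≡y j′ (drop-there (h (there (x∈⁅x⁆ j))))

  pair⊆ : ∀ {S : Subset (suc m)} {j} → zero ∈ S → suc j ∈ S → (inside ∷ ⁅ j ⁆) ⊆ S
  pair⊆ 0∈S sj∈S {zero}  _              = 0∈S
  pair⊆ {S} {j} 0∈S sj∈S {suc x} (there x∈⁅j⁆) =
    subst (λ z → suc z ∈ S) (sym (x∈⁅y⁆⇒x≡y j x∈⁅j⁆)) sj∈S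

  point-below : ∀ y → ¬ (y ≤F ∅F) → Σ[ q ∈ Fin (suc m) ] sing q ≤F y
  point-below top       _    = zero , sing zero ≤top
  point-below (sub S _) y≰∅ with nonempty? S
  ... | yes (q , q∈S) = q , sub≤sub (x∈p⇒⁅x⁆⊆p q∈S)
  ... | no  S-empty   = ⊥-elim (y≰∅ (sub≤sub (λ {q} q∈S → ⊥-elim (S-empty (q , q∈S)))))

  sing-covers-∅F : ∀ q → Covers _≤F_ ∅F (sing q)
  sing-covers-∅F q = ∅F-least (sing q) , sing≰∅F , squeeze
    where
    sing≰∅F : ¬ (sing q ≤F ∅F)
    sing≰∅F sing≤∅ = ∉⊥ (sing≤sub⇒∈ sing≤∅)

    squeeze : ∀ y → ∅F ≤F y → y ≤F sing q → (y ≤F ∅F) ⊎ (sing q ≤F y)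
    squeeze (sub S _) _ (sub≤sub S⊆⁅q⁆) with q ∈? S
    ... | yes q∈S = inj₂ (sub≤sub (x∈p⇒⁅x⁆⊆p q∈S))
    ... | no  q∉S = inj₁ (sub≤sub λ {x} x∈S →
                      ⊥-elim (q∉S (subst (_∈ S) (x∈⁅y⁆⇒x≡y q (S⊆⁅q⁆ x∈S)) x∈S)))

  pair-covers-sing0 : ∀ j → Covers _≤F_ (sing zero) (pair j)
  pair-covers-sing0 j = sub≤sub sing0⊆pair , pair≰sing0 , squeeze
    where
    sing0⊆pair : ⁅ zero ⁆ ⊆ (inside ∷ ⁅ j ⁆)
    sing0⊆pair {zero}  _           = here
    sing0⊆pair {suc x} (there x∈∅) = ⊥-elim (∉⊥ x∈∅)

    pair≰sing0 : ¬ (pair j ≤F sing zero)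
    pair≰sing0 (sub≤sub h) = ∉⊥ (drop-there (h (there (x∈⁅x⁆ j))))

    squeeze : ∀ y → sing zero ≤F y → y ≤F pair j → (y ≤F sing zero) ⊎ (pair j ≤F y)
    squeeze (sub S _) sing0≤y (sub≤sub S⊆pair) with suc j ∈? S
    ... | yes sj∈S = inj₂ (sub≤sub (pair⊆ (sing≤sub⇒∈ sing0≤y) sj∈S))
    ... | no  sj∉S = inj₁ (sub≤sub S⊆⁅0⁆)
      where
      S⊆⁅0⁆ : S ⊆ ⁅ zero ⁆
      S⊆⁅0⁆ {zero}  _      = here
      S⊆⁅0⁆ {suc x} sx∈S = ⊥-elim (sj∉S (subst (λ z → suc z ∈ S)
                               (x∈⁅y⁆⇒x≡y j (drop-there (S⊆pair sx∈S))) sx∈S))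

  above-sing0 : Fin m → ∀ y → sing zero ≤F y → (y ≤F sing zero) ⊎ (Σ[ j ∈ Fin m ] pair j ≤F y)
  above-sing0 j₀ top _ = inj₂ (j₀ , pair j₀ ≤top)
  above-sing0 j₀ (sub (b ∷ S) _) sing0≤y with nonempty? S
  ... | yes (j , j∈S) = inj₂ (j , sub≤sub (pair⊆ (sing≤sub⇒∈ sing0≤y) (there j∈S)))
  ... | no  S-empty   = inj₁ (sub≤sub y⊆⁅0⁆)
    where
    y⊆⁅0⁆ : (b ∷ S) ⊆ ⁅ zero ⁆
    y⊆⁅0⁆ {zero}  _             = here
    y⊆⁅0⁆ {suc x} (there x∈S) = ⊥-elim (S-empty (x , x∈S))

module CoreOfUpho {k m : ℕ} (2<k : 2 < k) (k≤m : k ℕ.≤ m) (L : UphoLattice)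
                  (core : UphoLattice.CoreIso L (Flat k (suc m)) _≤F_) where
  open UphoLattice L renaming (refl to ≤-refl; trans to ≤-trans)
  open PosetProperties poset
  open UniformFlats {k} {m} 2<k

  t : Carrier
  t = proj₁ core

  atom⇒≤t : ∀ {a} → IsAtom a → a ≤ t
  atom⇒≤t {a} = proj₁ (proj₁ (proj₂ core)) a

  open IntervalIsoProperties (proj₂ (proj₂ core))

  s : Carrier
  s = φ (sing zero)

  open FilterIsoProperties 𝟘-min (upho s)

  φ∅F≡𝟘 : φ ∅F ≡ 𝟘
  φ∅F≡𝟘 = φ-least ∅F-least

  ≤∅F⇒φ≡𝟘 : ∀ {y} → y ≤F ∅F → φ y ≡ 𝟘
  ≤∅F⇒φ≡𝟘 {y} y≤∅F = antisym (subst (φ y ≤_) φ∅F≡𝟘 (φ-mono y≤∅F)) (𝟘-min (φ y))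

  sing-atom : ∀ q → IsAtom (φ (sing q))
  sing-atom q = subst (_⋖ φ (sing q)) φ∅F≡𝟘 (φ-covers (sing-covers-∅F q))

  s⋖pair : ∀ j → s ⋖ φ (pair j)
  s⋖pair j = φ-covers (pair-covers-sing0 j)

  in-core : ∀ {y} → y ≤ t → Σ[ x ∈ Flat k (suc m) ] φ x ≡ y
  in-core {y} = φ-onto y (𝟘-min y)

  atom-in-core⇒sing : ∀ {a} → IsAtom a → a ≤ t → Σ[ q ∈ Fin (suc m) ] φ (sing q) ≡ a
  atom-in-core⇒sing a-atom a≤t with in-core a≤t
  ... | y , refl with point-below y (λ y≤∅F → proj₂ (proj₁ a-atom) (sym (≤∅F⇒φ≡𝟘 y≤∅F)))
  ... | q , sing≤y = q , ⋖-<ₚ-≤⇒≡ a-atom (proj₁ (sing-atom q)) (φ-mono sing≤y)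

  s-cover-in-core⇒pair : Fin m → ∀ {c} → s ⋖ c → c ≤ t → Σ[ j ∈ Fin m ] φ (pair j) ≡ c
  s-cover-in-core⇒pair j₀ s⋖c c≤t with in-core c≤t
  ... | y , refl with above-sing0 j₀ y (φ-reflects (proj₁ (proj₁ s⋖c)))
  ... | inj₁ y≤sing0   = ⊥-elim (proj₂ (proj₁ s⋖c) (antisym (proj₁ (proj₁ s⋖c)) (φ-mono y≤sing0)))
  ... | inj₂ (j , pair≤y) = j , ⋖-<ₚ-≤⇒≡ s⋖c (proj₁ (s⋖pair j)) (φ-mono pair≤y)

  pair-atom : Fin m → Carrier
  pair-atom j = proj₁ (f-onto (φ (pair j)) (proj₁ (proj₁ (s⋖pair j))))

  f-pair-atom : ∀ j → f (pair-atom j) ≡ φ (pair j)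
  f-pair-atom j = proj₂ (f-onto (φ (pair j)) (proj₁ (proj₁ (s⋖pair j))))

  pair-atom-isAtom : ∀ j → IsAtom (pair-atom j)
  pair-atom-isAtom j = p⋖f⇒atom (subst (s ⋖_) (sym (f-pair-atom j)) (s⋖pair j))

  pair-atom-injective : Injective _≡_ _≡_ pair-atom
  pair-atom-injective {i} {j} e = pair-injective (φ-reflects (≡⇒≤ φpairᵢ≡φpairⱼ))
    where
    φpairᵢ≡φpairⱼ : φ (pair i) ≡ φ (pair j)
    φpairᵢ≡φpairⱼ = trans (sym (f-pair-atom i)) (trans (cong f e) (f-pair-atom j))

  -- m pairwise distinct atoms lie below φ x, but a proper flat has fewer than k ≤ m points.
  ≥pair-atoms⇒≥t : ∀ x → (∀ j → pair-atom j ≤ φ x) → t ≤ φ x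
  ≥pair-atoms⇒≥t top       _ = ≡⇒≤ (sym (φ-greatest _≤top))
  ≥pair-atoms⇒≥t (sub S ∣S∣<k) pair-atom≤φx =
    ⊥-elim (n≮n m (<-≤-trans (≤-<-trans m≤∣S∣ ∣S∣<k) k≤m))
    where
    point : Fin m → Fin (suc m)
    point j = proj₁ (atom-in-core⇒sing (pair-atom-isAtom j) (atom⇒≤t (pair-atom-isAtom j)))

    φ-point : ∀ j → φ (sing (point j)) ≡ pair-atom j
    φ-point j = proj₂ (atom-in-core⇒sing (pair-atom-isAtom j) (atom⇒≤t (pair-atom-isAtom j)))

    point-injective : Injective _≡_ _≡_ point
    point-injective {i} {j} e =
      pair-atom-injective (trans (sym (φ-point i)) (trans (cong (φ ∘ sing) e) (φ-point j)))

    point∈S : ∀ j → point j ∈ S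
    point∈S j = sing≤sub⇒∈ (φ-reflects (subst (_≤ φ (sub S ∣S∣<k)) (sym (φ-point j)) (pair-atom≤φx j)))

    m≤∣S∣ : m ℕ.≤ ∣ S ∣
    m≤∣S∣ = ∈-injection⇒≤∣p∣ point point-injective S point∈S

  w : Carrier
  w = proj₁ (f-onto t (φ≤b (sing zero)))

  f-w : f w ≡ t
  f-w = proj₂ (f-onto t (φ≤b (sing zero)))

  t≤w : t ≤ w
  t≤w with proj₂ lattice w t
  ... | w∧t , (w∧t≤w , w∧t≤t) , greatest with in-core w∧t≤t
  ... | x , refl = ≤-trans (≥pair-atoms⇒≥t x pair-atom≤w∧t) w∧t≤w
    where
    pair-atom≤w∧t : ∀ j → pair-atom j ≤ φ x
    pair-atom≤w∧t j = greatest (pair-atom j)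
      (f-reflects (subst₂ _≤_ (sym (f-pair-atom j)) (sym f-w) (φ≤b (pair j))))
      (atom⇒≤t (pair-atom-isAtom j))

  f-sing≤t : ∀ q → f (φ (sing q)) ≤ t
  f-sing≤t q = subst (f (φ (sing q)) ≤_) f-w (f-mono (≤-trans (φ≤b (sing q)) t≤w))

  j₀ : Fin m
  j₀ = fromℕ< (<-≤-trans 0<k k≤m)

  pair-of-sing : Fin (suc m) → Fin m
  pair-of-sing q = proj₁ (s-cover-in-core⇒pair j₀ (atom⇒p⋖f (sing-atom q)) (f-sing≤t q))

  pair-of-sing-injective : Injective _≡_ _≡_ pair-of-sing
  pair-of-sing-injective {q} {q′} e = sing-injective (φ-reflects (≡⇒≤ (f-injective fφsing≡fφsing′)))
    where
    φ-pair-of-sing : ∀ q → φ (pair (pair-of-sing q)) ≡ f (φ (sing q))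
    φ-pair-of-sing q = proj₂ (s-cover-in-core⇒pair j₀ (atom⇒p⋖f (sing-atom q)) (f-sing≤t q))

    fφsing≡fφsing′ : f (φ (sing q)) ≡ f (φ (sing q′))
    fφsing≡fφsing′ = trans (sym (φ-pair-of-sing q)) (trans (cong (φ ∘ pair) e) (φ-pair-of-sing q′))

theorem5p14 : (k n : ℕ) → 2 < k → k < n → (L : UphoLattice)
            → ¬ UphoLattice.CoreIso L (Flat k n) _≤F_
theorem5p14 k (suc m) 2<k (s≤s k≤m) L core = n≮n m (injective⇒≤ pair-of-sing-injective)
  where open CoreOfUpho 2<k k≤m L core
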